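{- Let $t,u$ be vsub-terms. If $d\colon t\to_{\mathsf{vsub}}^* u$, then there is a derivation $e\colon t\to_{\{\mathtt m,\mathtt e_\lambda\}}^*\to_{\mathtt e_{\mathtt{var}}}^* u$ (a sequence of $\mathtt m$- and $\mathtt e_\lambda$-steps followed by a sequence of $\mathtt e_{\mathtt{var}}$-steps) with $|e|=|d|$, $|e|_{\mathtt m}=|d|_{\mathtt m}$, $|e|_{\mathtt e}=|d|_{\mathtt e}$ and $|e|_{\mathtt e_\lambda}\ge|d|_{\mathtt e_\lambda}$.
   Context: Value substitution calculus: vsub-terms $t,u::= v\mid tu\mid t[x\leftarrow u]$, vsub-values $v::=x\mid\lambda x.t$; $t[x\leftarrow u]$ binds $x$ in $t$; up to $\alpha$; $t\{x\leftarrow u\}$ capture-avoiding substitution. Evaluation contexts $E::=\langle\cdot\rangle\mid tE\mid Et\mid E[x\leftarrow u]\mid t[x\leftarrow E]$; substitution contexts $L::=\langle\cdot\rangle\mid L[x\leftarrow u]$. Root rules: $L\langle\lambda x.t\rangle u\mapsto_{\mathtt m} L\langle t[x\leftarrow u]\rangle$; $t[x\leftarrow L\langle \lambda y.u\rangle]\mapsto_{\mathtt e_\lambda} L\langle t\{x\leftarrow\lambda y.u\}\rangle$; $t[x\leftarrow L\langle y\rangle]\mapsto_{\mathtt e_{\mathtt{var}}} L\langle t\{x\leftarrow y\}\rangle$ (variables bound by $L$ not free in $u$, resp. $t$). Their closures under evaluation contexts are $\to_{\mathtt m},\to_{\mathtt e_\lambda},\to_{\mathtt e_{\mathtt{var}}}$;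 $\to_{\mathtt e}=\to_{\mathtt e_\lambda}\cup\to_{\mathtt e_{\mathtt{var}}}$, $\to_{\mathsf{vsub}}=\to_{\mathtt m}\cup\to_{\mathtt e}$. $|d|$ is the length of $d$ and $|d|_{\mathsf r}$ the number of its $\mathsf r$-steps. -}

module Defs where

open import Data.Nat using (ℕ; zero; suc)
open import Data.Fin using (Fin; zero; suc)
open import Data.List using (List; []; _∷_; length)
open import Data.Bool using (Bool; true; false; if_then_else_)

-- vsub-terms with well-scoped de Bruijn indices (terms up to α).
-- es t u  represents  t[x←u]; x is the bound variable 0 of t.
data Tm (n : ℕ) : Set where
  var : Fin n → Tm n
  lam : Tm (suc n) → Tm n
  app : Tm n → Tm n → Tm n
  es  : Tm (suc n) → Tm n → Tm n

ext : ∀ {n m} → (Fin n → Fin m) → Fin (suc n) → Fin (suc m)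
ext ρ zero = zero
ext ρ (suc i) = suc (ρ i)

ren : ∀ {n m} → (Fin n → Fin m) → Tm n → Tm m
ren ρ (var i) = var (ρ i)
ren ρ (lam t) = lam (ren (ext ρ) t)
ren ρ (app t u) = app (ren ρ t) (ren ρ u)
ren ρ (es t u) = es (ren (ext ρ) t) (ren ρ u)

exts : ∀ {n m} → (Fin n → Tm m) → Fin (suc n) → Tm (suc m)
exts σ zero = var zero
exts σ (suc i) = ren suc (σ i)

sub : ∀ {n m} → (Fin n → Tm m) → Tm n → Tm m
sub σ (var i) = σ i
sub σ (lam t) = lam (sub (exts σ) t)
sub σ (app t u) = app (sub σ t) (sub σ u)
sub σ (es t u) = es (sub (exts σ) t) (sub σ u)

-- substitution contexts  L ::= ⟨·⟩ | L[x←u]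
-- SCtx n m : plugging a term with m variables in scope yields one with n.
data SCtx (n : ℕ) : ℕ → Set where
  hole : SCtx n n
  _⟪←_⟫ : ∀ {m} → SCtx (suc n) m → Tm n → SCtx n m

plug : ∀ {n m} → SCtx n m → Tm m → Tm n
plug hole t = t
plug (L ⟪← u ⟫) t = es (plug L t) u

-- weakening past the binders of L (implements "variables bound by L not free in ...")
wkL : ∀ {n m} → SCtx n m → Fin n → Fin m
wkL hole i = i
wkL (L ⟪← u ⟫) i = wkL L (suc i)

-- t{x←v} after moving t under L:  x ↦ v, other variables weakened past L
substL : ∀ {n m} → SCtx n m → Tm m → Fin (suc n) → Tm m
substL L v zero = v
substL L v (suc i) = var (wkL L i)

data Kind : Set where
  km keλ kevar : Kind

data Root {n : ℕ} : Kind → Tm n → Tm n → Set where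
  r-m    : ∀ {m} (L : SCtx n m) (t : Tm (suc m)) (u : Tm n) →
           Root km (app (plug L (lam t)) u) (plug L (es t (ren (wkL L) u)))
  r-eλ   : ∀ {m} (t : Tm (suc n)) (L : SCtx n m) (u : Tm (suc m)) →
           Root keλ (es t (plug L (lam u))) (plug L (sub (substL L (lam u)) t))
  r-evar : ∀ {m} (t : Tm (suc n)) (L : SCtx n m) (y : Fin m) →
           Root kevar (es t (plug L (var y))) (plug L (sub (substL L (var y)) t))

data Step {n : ℕ} (k : Kind) : Tm n → Tm n → Set where
  root : ∀ {t u} → Root k t u → Step k t u
  appL : ∀ {t t' u} → Step k t t' → Step k (app t u) (app t' u)
  appR : ∀ {t u u'} → Step k u u' → Step k (app t u) (app t u')
  esL  : ∀ {t t' u} → Step k t t' → Step k (es t u) (es t' u)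
  esR  : ∀ {t u u'} → Step k u u' → Step k (es t u) (es t u')

data Steps {n : ℕ} : List Kind → Tm n → Tm n → Set where
  done : ∀ {t} → Steps [] t t
  _∷_  : ∀ {k ks t s u} → Step k t s → Steps ks s u → Steps (k ∷ ks) t u

isM isE isEλ isEvar : Kind → Bool
isM km = true
isM _  = false
isE km = false
isE _  = true
isEλ keλ = true
isEλ _   = false
isEvar kevar = true
isEvar _     = false

count : (Kind → Bool) → List Kind → ℕ
count p [] = 0
count p (k ∷ ks) = if p k then suc (count p ks) else count p ks

-- An e_var step followed by an m- or e_λ-step can be swapped: the other step is performed
-- first and the e_var step turns into exactly one e-step. Substituting a variable is a renaming,
-- so every redex of t{x←y} is the image of a unique redex of t and nothing is duplicated or
-- erased; the only change is that an e_var redex may become an e_λ redex when the substituted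
-- variable has meanwhile been replaced by an abstraction, in which case that step is no longer an
-- e_var step and the postponement stops. Pushing each e_var step to the right in this way keeps
-- the length and the numbers of m- and e-steps and can only increase the number of e_λ-steps.

module Submission where

open import Defs
open import Data.Nat using (ℕ; suc; _≤_; _≥_; s≤s)
open import Data.Nat.Properties using (≤-refl; ≤-reflexive; ≤-trans; n≤1+n)
open import Data.Fin using (Fin; zero; suc)
open import Data.Vec.Functional using () renaming (_∷_ to _∷ᶠ_)
open import Data.List using (List; []; _∷_; length; _++_)
open import Data.List.Relation.Unary.All using (All; []; _∷_)
open import Data.Bool using (Bool; true; false; if_then_else_)
open import Data.Product using (Σ; _×_; _,_; ∃-syntax)
open import Data.Sum using (_⊎_; inj₁; inj₂)
open import Function using (id; _∘_)
open import Relation.Binary.PropositionalEquality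
  using (_≡_; _≗_; refl; sym; trans; cong; cong₂; subst; subst₂)

private variable
  n m l : ℕ
  k : Kind
  ks ks' ks'' : List Kind

ext-cong : {ρ ρ' : Fin n → Fin m} → ρ ≗ ρ' → ext ρ ≗ ext ρ'
ext-cong h zero    = refl
ext-cong h (suc i) = cong suc (h i)

ren-cong : {ρ ρ' : Fin n → Fin m} → ρ ≗ ρ' → ren ρ ≗ ren ρ'
ren-cong h (var i)   = cong var (h i)
ren-cong h (lam t)   = cong lam (ren-cong (ext-cong h) t)
ren-cong h (app t u) = cong₂ app (ren-cong h t) (ren-cong h u)
ren-cong h (es t u)  = cong₂ es (ren-cong (ext-cong h) t) (ren-cong h u)

exts-cong : {σ σ' : Fin n → Tm m} → σ ≗ σ' → exts σ ≗ exts σ'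
exts-cong h zero    = refl
exts-cong h (suc i) = cong (ren suc) (h i)

sub-cong : {σ σ' : Fin n → Tm m} → σ ≗ σ' → sub σ ≗ sub σ'
sub-cong h (var i)   = h i
sub-cong h (lam t)   = cong lam (sub-cong (exts-cong h) t)
sub-cong h (app t u) = cong₂ app (sub-cong h t) (sub-cong h u)
sub-cong h (es t u)  = cong₂ es (sub-cong (exts-cong h) t) (sub-cong h u)

ext-id : {ρ : Fin n → Fin n} → ρ ≗ id → ext ρ ≗ id
ext-id h zero    = refl
ext-id h (suc i) = cong suc (h i)

ren-id : {ρ : Fin n → Fin n} → ρ ≗ id → ren ρ ≗ id
ren-id h (var i)   = cong var (h i)
ren-id h (lam t)   = cong lam (ren-id (ext-id h) t)
ren-id h (app t u) = cong₂ app (ren-id h t) (ren-id h u)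
ren-id h (es t u)  = cong₂ es (ren-id (ext-id h) t) (ren-id h u)

ext-∘ : (ρ : Fin m → Fin l) (ρ' : Fin n → Fin m) → ext ρ ∘ ext ρ' ≗ ext (ρ ∘ ρ')
ext-∘ ρ ρ' zero    = refl
ext-∘ ρ ρ' (suc i) = refl

ren-∘ : (ρ : Fin m → Fin l) (ρ' : Fin n → Fin m) → ren ρ ∘ ren ρ' ≗ ren (ρ ∘ ρ')
ren-∘ ρ ρ' (var i)   = refl
ren-∘ ρ ρ' (lam t)   = cong lam (trans (ren-∘ (ext ρ) (ext ρ') t) (ren-cong (ext-∘ ρ ρ') t))
ren-∘ ρ ρ' (app t u) = cong₂ app (ren-∘ ρ ρ' t) (ren-∘ ρ ρ' u)
ren-∘ ρ ρ' (es t u)  =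
  cong₂ es (trans (ren-∘ (ext ρ) (ext ρ') t) (ren-cong (ext-∘ ρ ρ') t)) (ren-∘ ρ ρ' u)

ren-cancel : {ρ : Fin m → Fin n} {ρ' : Fin n → Fin m} → ρ ∘ ρ' ≗ id → ren ρ ∘ ren ρ' ≗ id
ren-cancel {ρ = ρ} {ρ'} h t = trans (ren-∘ ρ ρ' t) (ren-id h t)

ext-cancel : {ρ : Fin m → Fin n} {ρ' : Fin n → Fin m} → ρ ∘ ρ' ≗ id → ext ρ ∘ ext ρ' ≗ id
ext-cancel {ρ = ρ} {ρ'} h i = trans (ext-∘ ρ ρ' i) (ext-id h i)

exts-ext : (σ : Fin m → Tm l) (ρ : Fin n → Fin m) → exts σ ∘ ext ρ ≗ exts (σ ∘ ρ)
exts-ext σ ρ zero    = refl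
exts-ext σ ρ (suc i) = refl

sub-ren : (σ : Fin m → Tm l) (ρ : Fin n → Fin m) → sub σ ∘ ren ρ ≗ sub (σ ∘ ρ)
sub-ren σ ρ (var i)   = refl
sub-ren σ ρ (lam t)   = cong lam (trans (sub-ren (exts σ) (ext ρ) t) (sub-cong (exts-ext σ ρ) t))
sub-ren σ ρ (app t u) = cong₂ app (sub-ren σ ρ t) (sub-ren σ ρ u)
sub-ren σ ρ (es t u)  =
  cong₂ es (trans (sub-ren (exts σ) (ext ρ) t) (sub-cong (exts-ext σ ρ) t)) (sub-ren σ ρ u)

ren-exts : (ρ : Fin m → Fin l) (σ : Fin n → Tm m) → ren (ext ρ) ∘ exts σ ≗ exts (ren ρ ∘ σ)
ren-exts ρ σ zero    = refl
ren-exts ρ σ (suc i) = trans (ren-∘ (ext ρ) suc (σ i)) (sym (ren-∘ suc ρ (σ i)))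

ren-sub : (ρ : Fin m → Fin l) (σ : Fin n → Tm m) → ren ρ ∘ sub σ ≗ sub (ren ρ ∘ σ)
ren-sub ρ σ (var i)   = refl
ren-sub ρ σ (lam t)   = cong lam (trans (ren-sub (ext ρ) (exts σ) t) (sub-cong (ren-exts ρ σ) t))
ren-sub ρ σ (app t u) = cong₂ app (ren-sub ρ σ t) (ren-sub ρ σ u)
ren-sub ρ σ (es t u)  =
  cong₂ es (trans (ren-sub (ext ρ) (exts σ) t) (sub-cong (ren-exts ρ σ) t)) (ren-sub ρ σ u)

sub-exts : (σ : Fin m → Tm l) (τ : Fin n → Tm m) → sub (exts σ) ∘ exts τ ≗ exts (sub σ ∘ τ)
sub-exts σ τ zero    = refl
sub-exts σ τ (suc i) = trans (sub-ren (exts σ) suc (τ i)) (sym (ren-sub suc σ (τ i)))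

sub-sub : (σ : Fin m → Tm l) (τ : Fin n → Tm m) → sub σ ∘ sub τ ≗ sub (sub σ ∘ τ)
sub-sub σ τ (var i)   = refl
sub-sub σ τ (lam t)   = cong lam (trans (sub-sub (exts σ) (exts τ) t) (sub-cong (sub-exts σ τ) t))
sub-sub σ τ (app t u) = cong₂ app (sub-sub σ τ t) (sub-sub σ τ u)
sub-sub σ τ (es t u)  =
  cong₂ es (trans (sub-sub (exts σ) (exts τ) t) (sub-cong (sub-exts σ τ) t)) (sub-sub σ τ u)

exts-var : {σ : Fin n → Tm m} {ρ : Fin n → Fin m} → σ ≗ var ∘ ρ → exts σ ≗ var ∘ ext ρ
exts-var h zero    = refl
exts-var h (suc i) = cong (ren suc) (h i)

sub-var : {σ : Fin n → Tm m} {ρ : Fin n → Fin m} → σ ≗ var ∘ ρ → sub σ ≗ ren ρ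
sub-var h (var i)   = h i
sub-var h (lam t)   = cong lam (sub-var (exts-var h) t)
sub-var h (app t u) = cong₂ app (sub-var h t) (sub-var h u)
sub-var h (es t u)  = cong₂ es (sub-var (exts-var h) t) (sub-var h u)

sub-id : {σ : Fin n → Tm n} → σ ≗ var → sub σ ≗ id
sub-id h t = trans (sub-var {ρ = id} h t) (ren-id (λ _ → refl) t)

wk : Tm n → Tm (suc n)
wk = ren suc

lift : Tm (suc n) → Tm (suc (suc n))
lift = ren (ext suc)

_[_]₀ : Tm (suc n) → Tm n → Tm n
t [ v ]₀ = sub (substL hole v) t

ren-[]₀ : (ρ : Fin n → Fin m) (t : Tm (suc n)) (v : Tm n) →
          ren ρ (t [ v ]₀) ≡ ren (ext ρ) t [ ren ρ v ]₀
ren-[]₀ ρ t v = trans (ren-sub ρ (substL hole v) t)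
  (trans (sub-cong commute t) (sym (sub-ren (substL hole (ren ρ v)) (ext ρ) t)))
  where
  commute : ren ρ ∘ substL hole v ≗ substL hole (ren ρ v) ∘ ext ρ
  commute zero    = refl
  commute (suc i) = refl

sub-[]₀ : (σ : Fin n → Tm m) (t : Tm (suc n)) (v : Tm n) →
          sub σ (t [ v ]₀) ≡ sub (exts σ) t [ sub σ v ]₀
sub-[]₀ σ t v = trans (sub-sub σ (substL hole v) t)
  (trans (sub-cong commute t) (sym (sub-sub (substL hole (sub σ v)) (exts σ) t)))
  where
  commute : sub σ ∘ substL hole v ≗ sub (substL hole (sub σ v)) ∘ exts σ
  commute zero    = refl
  commute (suc i) = sym (trans (sub-ren _ suc (σ i)) (sub-id (λ _ → refl) (σ i)))

[]₀-lift : (t : Tm (suc n)) (v : Tm n) → sub (exts (substL hole v)) (lift t) ≡ t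
[]₀-lift t v = trans (sub-ren _ (ext suc) t) (sub-id cancel t)
  where
  cancel : exts (substL hole v) ∘ ext suc ≗ var
  cancel zero    = refl
  cancel (suc i) = refl

[var]₀-ren : (t : Tm (suc n)) (y : Fin n) → t [ var y ]₀ ≡ ren (y ∷ᶠ id) t
[var]₀-ren t y = sub-var pointwise t
  where
  pointwise : substL hole (var y) ≗ var ∘ (y ∷ᶠ id)
  pointwise zero    = refl
  pointwise (suc i) = refl

ren-ext-wk : (ρ : Fin n → Fin m) (u : Tm n) → ren (ext ρ) (wk u) ≡ wk (ren ρ u)
ren-ext-wk ρ u = trans (ren-∘ _ suc u) (sym (ren-∘ suc ρ u))

sub-exts-wk : (σ : Fin n → Tm m) (u : Tm n) → sub (exts σ) (wk u) ≡ wk (sub σ u)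
sub-exts-wk σ u = trans (sub-ren _ suc u) (sym (ren-sub suc σ u))

ren-ext²-lift : (ρ : Fin n → Fin m) (t : Tm (suc n)) →
                ren (ext (ext ρ)) (lift t) ≡ lift (ren (ext ρ) t)
ren-ext²-lift ρ t = trans (ren-∘ _ _ t) (trans (ren-cong commute t) (sym (ren-∘ _ _ t)))
  where
  commute : ext (ext ρ) ∘ ext suc ≗ ext suc ∘ ext ρ
  commute zero    = refl
  commute (suc i) = refl

sub-exts²-lift : (σ : Fin n → Tm m) (t : Tm (suc n)) →
                 sub (exts (exts σ)) (lift t) ≡ lift (sub (exts σ) t)
sub-exts²-lift σ t = trans (sub-ren _ _ t) (trans (sub-cong commute t) (sym (ren-sub (ext suc) (exts σ) t)))
  where
  commute : exts (exts σ) ∘ ext suc ≗ ren (ext suc) ∘ exts σ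
  commute zero    = refl
  commute (suc i) = trans (ren-∘ suc suc (σ i)) (sym (ren-∘ (ext suc) suc (σ i)))

-- The root rules with the substitution context L peeled off one explicit substitution at a
-- time: MRoot p u r means app p u ↦m r, and ERoot k t p c means es t p ↦k c.
data MRoot : Tm n → Tm n → Tm n → Set where
  m-here  : {t : Tm (suc n)} {u : Tm n} → MRoot (lam t) u (es t u)
  m-under : {p r : Tm (suc n)} {q u : Tm n} → MRoot p (wk u) r → MRoot (es p q) u (es r q)

data ERoot : Kind → Tm (suc n) → Tm n → Tm n → Set where
  eλ-here   : {t s : Tm (suc n)} → ERoot keλ t (lam s) (t [ lam s ]₀)
  evar-here : {t : Tm (suc n)} {y : Fin n} → ERoot kevar t (var y) (t [ var y ]₀)
  e-under   : {t p r : Tm (suc n)} {q : Tm n} → ERoot k (lift t) p r → ERoot k t (es p q) (es r q)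

data SStep : Kind → Tm n → Tm n → Set where
  m-root : {p u r : Tm n} → MRoot p u r → SStep km (app p u) r
  e-root : {t : Tm (suc n)} {p c : Tm n} → ERoot k t p c → SStep k (es t p) c
  appL   : {t t' u : Tm n} → SStep k t t' → SStep k (app t u) (app t' u)
  appR   : {t u u' : Tm n} → SStep k u u' → SStep k (app t u) (app t u')
  esL    : {t t' : Tm (suc n)} {u : Tm n} → SStep k t t' → SStep k (es t u) (es t' u)
  esR    : {t : Tm (suc n)} {u u' : Tm n} → SStep k u u' → SStep k (es t u) (es t u')

MRoot-plug : (L : SCtx n m) (t : Tm (suc m)) (u : Tm n) →
             MRoot (plug L (lam t)) u (plug L (es t (ren (wkL L) u)))
MRoot-plug hole t u = subst (MRoot (lam t) u ∘ es t) (sym (ren-id (λ _ → refl) u)) m-here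
MRoot-plug (L ⟪← q ⟫) t u =
  m-under (subst (MRoot (plug L (lam t)) (wk u) ∘ plug L ∘ es t) (ren-∘ (wkL L) suc u)
                 (MRoot-plug L t (wk u)))

substL-lift : (L : SCtx (suc n) m) (q : Tm n) (v : Tm m) (t : Tm (suc n)) →
              sub (substL L v) (lift t) ≡ sub (substL (L ⟪← q ⟫) v) t
substL-lift L q v t = trans (sub-ren (substL L v) (ext suc) t) (sub-cong pointwise t)
  where
  pointwise : substL L v ∘ ext suc ≗ substL (L ⟪← q ⟫) v
  pointwise zero    = refl
  pointwise (suc i) = refl

ERoot-plug : (L : SCtx n m) {v : Tm m} → (∀ t → ERoot k t v (t [ v ]₀)) →
             (t : Tm (suc n)) → ERoot k t (plug L v) (plug L (sub (substL L v) t))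
ERoot-plug hole here t = here t
ERoot-plug {k = k} (L ⟪← q ⟫) {v} here t =
  e-under (subst (ERoot k (lift t) (plug L v) ∘ plug L) (substL-lift L q v t) (ERoot-plug L here (lift t)))

Root⇒SStep : {a b : Tm n} → Root k a b → SStep k a b
Root⇒SStep (r-m L t u)    = m-root (MRoot-plug L t u)
Root⇒SStep (r-eλ t L u)   = e-root (ERoot-plug L (λ _ → eλ-here) t)
Root⇒SStep (r-evar t L y) = e-root (ERoot-plug L (λ _ → evar-here) t)

Step⇒SStep : {a b : Tm n} → Step k a b → SStep k a b
Step⇒SStep (root R) = Root⇒SStep R
Step⇒SStep (appL s) = appL (Step⇒SStep s)
Step⇒SStep (appR s) = appR (Step⇒SStep s)
Step⇒SStep (esL s)  = esL (Step⇒SStep s)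
Step⇒SStep (esR s)  = esR (Step⇒SStep s)

MRoot⇒Root : {p u r : Tm n} → MRoot p u r → Root km (app p u) r
MRoot⇒Root {u = u} (m-here {t = t}) =
  subst (Root km (app (lam t) u) ∘ es t) (ren-id (λ _ → refl) u) (r-m hole t u)
MRoot⇒Root {u = u} (m-under {q = q} R) with MRoot⇒Root R
... | r-m L t _ = subst (Root km (app (es (plug L (lam t)) q) u) ∘ (λ z → es (plug L (es t z)) q))
                        (sym (ren-∘ (wkL L) suc u)) (r-m (L ⟪← q ⟫) t u)

ERoot⇒Root : {t : Tm (suc n)} {p c : Tm n} → ERoot k t p c → Root k (es t p) c
ERoot⇒Root (eλ-here {t = t} {s = s}) = r-eλ t hole s
ERoot⇒Root (evar-here {t = t} {y = y}) = r-evar t hole y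
ERoot⇒Root {t = t} (e-under {q = q} R) with ERoot⇒Root R
... | r-eλ _ L u = subst (Root keλ (es t (es (plug L (lam u)) q)) ∘ (λ z → es (plug L z) q))
                         (sym (substL-lift L q (lam u) t)) (r-eλ t (L ⟪← q ⟫) u)
... | r-evar _ L y = subst (Root kevar (es t (es (plug L (var y)) q)) ∘ (λ z → es (plug L z) q))
                           (sym (substL-lift L q (var y) t)) (r-evar t (L ⟪← q ⟫) y)

SStep⇒Step : {a b : Tm n} → SStep k a b → Step k a b
SStep⇒Step (m-root R) = root (MRoot⇒Root R)
SStep⇒Step (e-root R) = root (ERoot⇒Root R)
SStep⇒Step (appL s)   = appL (SStep⇒Step s)
SStep⇒Step (appR s)   = appR (SStep⇒Step s)
SStep⇒Step (esL s)    = esL (SStep⇒Step s)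
SStep⇒Step (esR s)    = esR (SStep⇒Step s)

MRoot-ren : (ρ : Fin n → Fin m) {p u r : Tm n} → MRoot p u r → MRoot (ren ρ p) (ren ρ u) (ren ρ r)
MRoot-ren ρ m-here = m-here
MRoot-ren ρ (m-under {p = p} {r = r} {u = u} R) =
  m-under (subst (λ z → MRoot (ren (ext ρ) p) z (ren (ext ρ) r)) (ren-ext-wk ρ u) (MRoot-ren (ext ρ) R))

ERoot-ren : (ρ : Fin n → Fin m) {t : Tm (suc n)} {p c : Tm n} →
            ERoot k t p c → ERoot k (ren (ext ρ) t) (ren ρ p) (ren ρ c)
ERoot-ren ρ (eλ-here {t = t} {s = s}) =
  subst (ERoot keλ (ren (ext ρ) t) (lam (ren (ext ρ) s))) (sym (ren-[]₀ ρ t (lam s))) eλ-here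
ERoot-ren ρ (evar-here {t = t} {y = y}) =
  subst (ERoot kevar (ren (ext ρ) t) (var (ρ y))) (sym (ren-[]₀ ρ t (var y))) evar-here
ERoot-ren {k = k} ρ (e-under {t = t} {p = p} {r = r} R) =
  e-under (subst (λ z → ERoot k z (ren (ext ρ) p) (ren (ext ρ) r)) (ren-ext²-lift ρ t)
                 (ERoot-ren (ext ρ) R))

SStep-ren : (ρ : Fin n → Fin m) {a b : Tm n} → SStep k a b → SStep k (ren ρ a) (ren ρ b)
SStep-ren ρ (m-root R) = m-root (MRoot-ren ρ R)
SStep-ren ρ (e-root R) = e-root (ERoot-ren ρ R)
SStep-ren ρ (appL s)   = appL (SStep-ren ρ s)
SStep-ren ρ (appR s)   = appR (SStep-ren ρ s)
SStep-ren ρ (esL s)    = esL (SStep-ren (ext ρ) s)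
SStep-ren ρ (esR s)    = esR (SStep-ren ρ s)

MRoot-ren⁻¹ : (ρ : Fin n → Fin m) (p u : Tm n) {r : Tm m} → MRoot (ren ρ p) (ren ρ u) r →
              ∃[ r' ] MRoot p u r' × r ≡ ren ρ r'
MRoot-ren⁻¹ ρ (lam t) u m-here = es t u , m-here , refl
MRoot-ren⁻¹ ρ (es p q) u (m-under R)
  with MRoot-ren⁻¹ (ext ρ) p (wk u) (subst (λ z → MRoot _ z _) (sym (ren-ext-wk ρ u)) R)
... | r' , R' , refl = es r' q , m-under R' , refl

ERoot-ren⁻¹ : (ρ : Fin n → Fin m) (t : Tm (suc n)) (p : Tm n) {c : Tm m} →
              ERoot k (ren (ext ρ) t) (ren ρ p) c → ∃[ c' ] ERoot k t p c' × c ≡ ren ρ c'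
ERoot-ren⁻¹ ρ t (lam s) eλ-here   = t [ lam s ]₀ , eλ-here , sym (ren-[]₀ ρ t (lam s))
ERoot-ren⁻¹ ρ t (var y) evar-here = t [ var y ]₀ , evar-here , sym (ren-[]₀ ρ t (var y))
ERoot-ren⁻¹ ρ t (es p q) (e-under R)
  with ERoot-ren⁻¹ (ext ρ) (lift t) p (subst (λ z → ERoot _ z _ _) (sym (ren-ext²-lift ρ t)) R)
... | c' , R' , refl = es c' q , e-under R' , refl

SStep-ren⁻¹ : (ρ : Fin n → Fin m) (a : Tm n) {b : Tm m} → SStep k (ren ρ a) b →
              ∃[ a' ] SStep k a a' × b ≡ ren ρ a'
SStep-ren⁻¹ ρ (var i) ()
SStep-ren⁻¹ ρ (lam t) ()
SStep-ren⁻¹ ρ (app p u) (m-root R) with MRoot-ren⁻¹ ρ p u R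
... | r' , R' , eq = r' , m-root R' , eq
SStep-ren⁻¹ ρ (app t u) (appL s) with SStep-ren⁻¹ ρ t s
... | t' , s' , refl = app t' u , appL s' , refl
SStep-ren⁻¹ ρ (app t u) (appR s) with SStep-ren⁻¹ ρ u s
... | u' , s' , refl = app t u' , appR s' , refl
SStep-ren⁻¹ ρ (es t p) (e-root R) with ERoot-ren⁻¹ ρ t p R
... | c' , R' , eq = c' , e-root R' , eq
SStep-ren⁻¹ ρ (es t u) (esL s) with SStep-ren⁻¹ (ext ρ) t s
... | t' , s' , refl = es t' u , esL s' , refl
SStep-ren⁻¹ ρ (es t u) (esR s) with SStep-ren⁻¹ ρ u s
... | u' , s' , refl = es t u' , esR s' , refl

-- Substituting a value for a variable can turn an e_var redex into an e_λ redex.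
data _≼_ : Kind → Kind → Set where
  ≼-refl  : k ≼ k
  evar≼eλ : kevar ≼ keλ

data Value : Tm n → Set where
  var-value : {i : Fin n} → Value (var i)
  lam-value : {t : Tm (suc n)} → Value (lam t)

Values : (Fin n → Tm m) → Set
Values σ = ∀ i → Value (σ i)

Value-ren : (ρ : Fin n → Fin m) {v : Tm n} → Value v → Value (ren ρ v)
Value-ren ρ var-value = var-value
Value-ren ρ lam-value = lam-value

Values-exts : {σ : Fin n → Tm m} → Values σ → Values (exts σ)
Values-exts vs zero    = var-value
Values-exts vs (suc i) = Value-ren suc (vs i)

Values-[]₀ : {v : Tm n} → Value v → Values (substL hole v)
Values-[]₀ v zero    = v
Values-[]₀ v (suc i) = var-value

ERoot-value : {v : Tm n} → Value v → (t : Tm (suc n)) → ∃[ k ] kevar ≼ k × ERoot k t v (t [ v ]₀)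
ERoot-value var-value t = kevar , ≼-refl , evar-here
ERoot-value lam-value t = keλ , evar≼eλ , eλ-here

MRoot-sub : (σ : Fin n → Tm m) {p u r : Tm n} → MRoot p u r → MRoot (sub σ p) (sub σ u) (sub σ r)
MRoot-sub σ m-here = m-here
MRoot-sub σ (m-under {p = p} {r = r} {u = u} R) =
  m-under (subst (λ z → MRoot (sub (exts σ) p) z (sub (exts σ) r)) (sub-exts-wk σ u) (MRoot-sub (exts σ) R))

ERoot-sub : (σ : Fin n → Tm m) → Values σ → {t : Tm (suc n)} {p c : Tm n} → ERoot k t p c →
            ∃[ k' ] k ≼ k' × ERoot k' (sub (exts σ) t) (sub σ p) (sub σ c)
ERoot-sub σ vs (eλ-here {t = t} {s = s}) =
  keλ , ≼-refl ,
  subst (ERoot keλ (sub (exts σ) t) (lam (sub (exts σ) s))) (sym (sub-[]₀ σ t (lam s))) eλ-here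
ERoot-sub σ vs (evar-here {t = t} {y = y}) with ERoot-value (vs y) (sub (exts σ) t)
... | k' , k≼k' , R = k' , k≼k' , subst (ERoot k' (sub (exts σ) t) (σ y)) (sym (sub-[]₀ σ t (var y))) R
ERoot-sub σ vs (e-under {t = t} {p = p} {r = r} R) with ERoot-sub (exts σ) (Values-exts vs) R
... | k' , k≼k' , R' =
  k' , k≼k' , e-under (subst (λ z → ERoot k' z (sub (exts σ) p) (sub (exts σ) r)) (sub-exts²-lift σ t) R')

SStep-sub : (σ : Fin n → Tm m) → Values σ → {a b : Tm n} → SStep k a b →
            ∃[ k' ] k ≼ k' × SStep k' (sub σ a) (sub σ b)
SStep-sub σ vs (m-root R) = km , ≼-refl , m-root (MRoot-sub σ R)
SStep-sub σ vs (e-root R) with ERoot-sub σ vs R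
... | k' , k≼k' , R' = k' , k≼k' , e-root R'
SStep-sub σ vs (appL s) with SStep-sub σ vs s
... | k' , k≼k' , s' = k' , k≼k' , appL s'
SStep-sub σ vs (appR s) with SStep-sub σ vs s
... | k' , k≼k' , s' = k' , k≼k' , appR s'
SStep-sub σ vs (esL s) with SStep-sub (exts σ) (Values-exts vs) s
... | k' , k≼k' , s' = k' , k≼k' , esL s'
SStep-sub σ vs (esR s) with SStep-sub σ vs s
... | k' , k≼k' , s' = k' , k≼k' , esR s'

m-after-evar-root : {w : Tm (suc n)} {q p u c : Tm n} → ERoot kevar w q p → MRoot p u c →
                    ∃[ A ] MRoot w (wk u) A × ERoot kevar A q c
m-after-evar-root {w = w} {u = u} (evar-here {y = y}) R
  with MRoot-ren⁻¹ (y ∷ᶠ id) w (wk u)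
         (subst₂ (λ a b → MRoot a b _) ([var]₀-ren w y) (sym (ren-cancel (λ _ → refl) u)) R)
... | A , M , refl = A , M , subst (ERoot kevar A (var y)) ([var]₀-ren A y) evar-here
m-after-evar-root {w = w} {u = u} (e-under E) (m-under R) with m-after-evar-root E R
... | _ , M' , E' with MRoot-ren⁻¹ (ext suc) w (wk u) (subst (λ z → MRoot _ z _) (sym (ren-ext-wk suc u)) M')
...   | A , M , refl = A , M , e-under E'

m-after-evarˡ : {a b u c : Tm n} → SStep kevar a b → MRoot b u c → ∃[ A ] MRoot a u A × SStep kevar A c
m-after-evarˡ (e-root E) R with m-after-evar-root E R
... | A , M , E' = es A _ , m-under M , e-root E'
m-after-evarˡ (esL e) (m-under R) with m-after-evarˡ e R
... | A , M , s = es A _ , m-under M , esL s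
m-after-evarˡ (esR e) (m-under R) = _ , m-under R , esR e

m-after-evarʳ : {p a b c : Tm n} → MRoot p b c → SStep kevar a b → ∃[ A ] MRoot p a A × SStep kevar A c
m-after-evarʳ m-here e = _ , m-here , esR e
m-after-evarʳ (m-under R) e with m-after-evarʳ R (SStep-ren suc e)
... | A , M , s = es A _ , m-under M , esL s

e-after-evarˡ : {a b : Tm (suc n)} {p c : Tm n} → ERoot k b p c → SStep kevar a b →
                ∃[ A ] ∃[ k' ] ERoot k a p A × kevar ≼ k' × SStep k' A c
e-after-evarˡ (eλ-here {s = s}) e with SStep-sub (substL hole (lam s)) (Values-[]₀ lam-value) e
... | k' , ≼k' , s' = _ , k' , eλ-here , ≼k' , s'
e-after-evarˡ (evar-here {y = y}) e with SStep-sub (substL hole (var y)) (Values-[]₀ var-value) e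
... | k' , ≼k' , s' = _ , k' , evar-here , ≼k' , s'
e-after-evarˡ (e-under R) e with e-after-evarˡ R (SStep-ren (ext suc) e)
... | A , k' , R' , ≼k' , s = es A _ , k' , e-under R' , ≼k' , esL s

e-after-evar-rootʳ : {w t : Tm (suc n)} {q b c : Tm n} → ERoot kevar w q b → ERoot k t b c →
                     ∃[ A ] ERoot k (lift t) w A × ERoot kevar A q c
e-after-evar-rootʳ {w = w} {t = t} (evar-here {y = y}) R
  with ERoot-ren⁻¹ (y ∷ᶠ id) (lift t) w
         (subst₂ (λ a b → ERoot _ a b _)
                 (sym (ren-cancel (ext-cancel (λ _ → refl)) t)) ([var]₀-ren w y) R)
... | A , N , refl = A , N , subst (ERoot kevar A (var y)) ([var]₀-ren A y) evar-here
e-after-evar-rootʳ {w = w} {t = t} (e-under E) (e-under R) with e-after-evar-rootʳ E R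
... | _ , N' , E'
  with ERoot-ren⁻¹ (ext suc) (lift t) w (subst (λ z → ERoot _ z _ _) (sym (ren-ext²-lift suc t)) N')
...   | A , N , refl = A , N , e-under E'

e-after-evarʳ : {t : Tm (suc n)} {a b c : Tm n} → SStep kevar a b → ERoot k t b c →
                ∃[ A ] ERoot k t a A × SStep kevar A c
e-after-evarʳ (e-root E) R with e-after-evar-rootʳ E R
... | A , N , E' = es A _ , e-under N , e-root E'
e-after-evarʳ (esL e) (e-under R) with e-after-evarʳ e R
... | A , N , s = es A _ , e-under N , esL s
e-after-evarʳ (esR e) (e-under R) = _ , e-under R , esR e

e-after-evar-under : {t p r : Tm (suc n)} {q c : Tm n} → ERoot kevar (lift t) p r → ERoot k r q c →
                     isEvar k ≡ false → ∃[ P ] ∃[ k' ] ERoot k p q P × kevar ≼ k' × ERoot k' t P c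
e-after-evar-under {t = t} E (eλ-here {s = s}) _ with ERoot-sub (substL hole (lam s)) (Values-[]₀ lam-value) E
... | k' , ≼k' , E' = _ , k' , eλ-here , ≼k' , subst (λ z → ERoot k' z _ _) ([]₀-lift t (lam s)) E'
e-after-evar-under E evar-here ()
e-after-evar-under {t = t} E (e-under R) h
  with e-after-evar-under (subst (λ z → ERoot kevar z _ _) (ren-ext²-lift suc t) (ERoot-ren (ext suc) E)) R h
... | P , k' , N , ≼k' , M = es P _ , k' , e-under N , ≼k' , e-under M

data InnerES (k : Kind) : Tm (suc n) → Tm n → Tm (suc n) → Tm n → Set where
  body : {t t' : Tm (suc n)} {p : Tm n} → SStep k t t' → InnerES k t p t' p
  arg  : {t : Tm (suc n)} {p p' : Tm n} → SStep k p p' → InnerES k t p t p'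

InnerES⇒SStep : {t t' : Tm (suc n)} {p p' : Tm n} → InnerES k t p t' p' → SStep k (es t p) (es t' p')
InnerES⇒SStep (body s) = esL s
InnerES⇒SStep (arg s)  = esR s

e-after-evar-root : {t : Tm (suc n)} {p b c : Tm n} → ERoot kevar t p b → SStep k b c →
                    isEvar k ≡ false →
                    ∃[ t' ] ∃[ p' ] ∃[ k' ] InnerES k t p t' p' × kevar ≼ k' × ERoot k' t' p' c
e-after-evar-root {t = t} (evar-here {y = y}) s _
  with SStep-ren⁻¹ (y ∷ᶠ id) t (subst (λ z → SStep _ z _) ([var]₀-ren t y) s)
... | t' , s' , refl =
  t' , var y , kevar , body s' , ≼-refl , subst (ERoot kevar t' (var y)) ([var]₀-ren t' y) evar-here
e-after-evar-root (e-under E) (e-root R) h with e-after-evar-under E R h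
... | P , k' , N , ≼k' , M = _ , P , k' , arg (e-root N) , ≼k' , M
e-after-evar-root {t = t} (e-under E) (esL s) h with e-after-evar-root E s h
... | _ , _ , k' , arg s' , ≼k' , R = _ , _ , k' , arg (esL s') , ≼k' , e-under R
... | _ , _ , k' , body s' , ≼k' , R with SStep-ren⁻¹ (ext suc) t s'
...   | t' , s'' , refl = t' , _ , k' , body s'' , ≼k' , e-under R
e-after-evar-root (e-under E) (esR s) _ = _ , _ , kevar , arg (esR s) , ≼-refl , e-under E

swap-evar : {a b c : Tm n} → SStep kevar a b → SStep k b c → isEvar k ≡ false →
            ∃[ a' ] ∃[ k' ] SStep k a a' × kevar ≼ k' × SStep k' a' c
swap-evar (e-root E) s h with e-after-evar-root E s h
... | _ , _ , k' , inner , ≼k' , R = _ , k' , InnerES⇒SStep inner , ≼k' , e-root R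
swap-evar (appL e) (m-root R) _ with m-after-evarˡ e R
... | A , M , s = A , kevar , m-root M , ≼-refl , s
swap-evar (appL e) (appL s) h with swap-evar e s h
... | _ , k' , s' , ≼k' , e' = _ , k' , appL s' , ≼k' , appL e'
swap-evar (appL e) (appR s) _ = _ , kevar , appR s , ≼-refl , appL e
swap-evar (appR e) (m-root R) _ with m-after-evarʳ R e
... | A , M , s = A , kevar , m-root M , ≼-refl , s
swap-evar (appR e) (appL s) _ = _ , kevar , appL s , ≼-refl , appR e
swap-evar (appR e) (appR s) h with swap-evar e s h
... | _ , k' , s' , ≼k' , e' = _ , k' , appR s' , ≼k' , appR e'
swap-evar (esL e) (e-root R) _ with e-after-evarˡ R e
... | A , k' , R' , ≼k' , s = A , k' , e-root R' , ≼k' , s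
swap-evar (esL e) (esL s) h with swap-evar e s h
... | _ , k' , s' , ≼k' , e' = _ , k' , esL s' , ≼k' , esL e'
swap-evar (esL e) (esR s) _ = _ , kevar , esR s , ≼-refl , esL e
swap-evar (esR e) (e-root R) _ with e-after-evarʳ e R
... | A , N , s = A , kevar , e-root N , ≼-refl , s
swap-evar (esR e) (esL s) _ = _ , kevar , esL s , ≼-refl , esR e
swap-evar (esR e) (esR s) h with swap-evar e s h
... | _ , k' , s' , ≼k' , e' = _ , k' , esR s' , ≼k' , esR e'

Step-swap-evar : {a b c : Tm n} → Step kevar a b → Step k b c → isEvar k ≡ false →
                 ∃[ a' ] ∃[ k' ] Step k a a' × kevar ≼ k' × Step k' a' c
Step-swap-evar e s h with swap-evar (Step⇒SStep e) (Step⇒SStep s) h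
... | a' , k' , s' , ≼k' , e' = a' , k' , SStep⇒Step s' , ≼k' , SStep⇒Step e'

infix 4 _⇝_

data _⇝_ : List Kind → List Kind → Set where
  ⇝-refl    : ks ⇝ ks
  ⇝-prep    : ks ⇝ ks' → k ∷ ks ⇝ k ∷ ks'
  ⇝-swap    : {k' : Kind} → k ∷ k' ∷ ks ⇝ k' ∷ k ∷ ks
  ⇝-upgrade : kevar ∷ ks ⇝ keλ ∷ ks
  ⇝-trans   : ks ⇝ ks' → ks' ⇝ ks'' → ks ⇝ ks''

⇝-++ʳ : (zs : List Kind) → ks ⇝ ks' → ks ++ zs ⇝ ks' ++ zs
⇝-++ʳ zs ⇝-refl        = ⇝-refl
⇝-++ʳ zs (⇝-prep q)    = ⇝-prep (⇝-++ʳ zs q)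
⇝-++ʳ zs ⇝-swap        = ⇝-swap
⇝-++ʳ zs ⇝-upgrade     = ⇝-upgrade
⇝-++ʳ zs (⇝-trans q r) = ⇝-trans (⇝-++ʳ zs q) (⇝-++ʳ zs r)

⇝-move : (ks : List Kind) {zs : List Kind} → k ∷ ks ++ zs ⇝ ks ++ k ∷ zs
⇝-move []       = ⇝-refl
⇝-move (_ ∷ ks) = ⇝-trans ⇝-swap (⇝-prep (⇝-move ks))

⇝-length : ks ⇝ ks' → length ks ≡ length ks'
⇝-length ⇝-refl        = refl
⇝-length (⇝-prep q)    = cong suc (⇝-length q)
⇝-length ⇝-swap        = refl
⇝-length ⇝-upgrade     = refl
⇝-length (⇝-trans q r) = trans (⇝-length q) (⇝-length r)

count-swap : (p : Kind → Bool) (k k' : Kind) (ks : List Kind) →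
             count p (k ∷ k' ∷ ks) ≡ count p (k' ∷ k ∷ ks)
count-swap p k k' ks with p k | p k'
... | false | false = refl
... | false | true  = refl
... | true  | false = refl
... | true  | true  = refl

⇝-count : (p : Kind → Bool) → p kevar ≡ p keλ → ks ⇝ ks' → count p ks ≡ count p ks'
⇝-count p h ⇝-refl                         = refl
⇝-count p h (⇝-prep {k = k} q)             = cong (λ c → if p k then suc c else c) (⇝-count p h q)
⇝-count p h (⇝-swap {k = k} {ks} {k'})     = count-swap p k k' ks
⇝-count p h (⇝-upgrade {ks = ks})          = cong (λ b → if b then suc (count p ks) else count p ks) h
⇝-count p h (⇝-trans q r)                  = trans (⇝-count p h q) (⇝-count p h r)

⇝-count-eλ : ks ⇝ ks' → count isEλ ks ≤ count isEλ ks'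
⇝-count-eλ ⇝-refl                     = ≤-refl
⇝-count-eλ (⇝-prep {k = km} q)        = ⇝-count-eλ q
⇝-count-eλ (⇝-prep {k = keλ} q)       = s≤s (⇝-count-eλ q)
⇝-count-eλ (⇝-prep {k = kevar} q)     = ⇝-count-eλ q
⇝-count-eλ (⇝-swap {k = k} {ks} {k'}) = ≤-reflexive (count-swap isEλ k k' ks)
⇝-count-eλ ⇝-upgrade                  = n≤1+n _
⇝-count-eλ (⇝-trans q r)              = ≤-trans (⇝-count-eλ q) (⇝-count-eλ r)

postpone-evar : {a b c : Tm n} → Step kevar a b → Steps ks b c → All (λ k → isEvar k ≡ false) ks →
                (∃[ a' ] Steps ks a a' × Step kevar a' c)
                ⊎ (∃[ ks' ] Steps ks' a c × All (λ k → isEvar k ≡ false) ks' × kevar ∷ ks ⇝ ks')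
postpone-evar e done [] = inj₁ (_ , done , e)
postpone-evar e (s ∷ ss) (h ∷ hs) with Step-swap-evar e s h
... | _ , _ , s' , evar≼eλ , e' =
  inj₂ (_ , s' ∷ e' ∷ ss , h ∷ refl ∷ hs , ⇝-trans ⇝-swap (⇝-prep ⇝-upgrade))
... | _ , _ , s' , ≼-refl , e' with postpone-evar e' ss hs
...   | inj₁ (_ , ss' , e'')      = inj₁ (_ , s' ∷ ss' , e'')
...   | inj₂ (_ , ss' , hs' , q) = inj₂ (_ , s' ∷ ss' , h ∷ hs' , ⇝-trans ⇝-swap (⇝-prep q))

record Postponement (t u : Tm n) (ds : List Kind) : Set where
  constructor postponement
  field
    es₁ es₂        : List Kind
    mid            : Tm n
    early          : Steps es₁ t mid
    late           : Steps es₂ mid u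
    early-non-evar : All (λ k → isEvar k ≡ false) es₁
    late-evar      : All (λ k → isEvar k ≡ true) es₂
    reshuffled     : ds ⇝ es₁ ++ es₂

prepend : {t s u : Tm n} → Step k t s → isEvar k ≡ false → Postponement s u ks →
          Postponement t u (k ∷ ks)
prepend s h (postponement es₁ es₂ _ d₁ d₂ h₁ h₂ q) =
  postponement (_ ∷ es₁) es₂ _ (s ∷ d₁) d₂ (h ∷ h₁) h₂ (⇝-prep q)

prepend-evar : {t s u : Tm n} → Step kevar t s → Postponement s u ks → Postponement t u (kevar ∷ ks)
prepend-evar e (postponement es₁ es₂ _ d₁ d₂ h₁ h₂ q) with postpone-evar e d₁ h₁
... | inj₁ (_ , d₁' , e') =
  postponement es₁ (kevar ∷ es₂) _ d₁' (e' ∷ d₂) h₁ (refl ∷ h₂) (⇝-trans (⇝-prep q) (⇝-move es₁))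
... | inj₂ (es₁' , d₁' , h₁' , q') =
  postponement es₁' es₂ _ d₁' d₂ h₁' h₂ (⇝-trans (⇝-prep q) (⇝-++ʳ es₂ q'))

postpone : {t u : Tm n} → Steps ks t u → Postponement t u ks
postpone done                   = postponement [] [] _ done done [] [] ⇝-refl
postpone (_∷_ {k = km} s ss)    = prepend s refl (postpone ss)
postpone (_∷_ {k = keλ} s ss)   = prepend s refl (postpone ss)
postpone (_∷_ {k = kevar} e ss) = prepend-evar e (postpone ss)

lemma5 : ∀ {n} {t u : Tm n} {ds : List Kind} → Steps ds t u →
    Σ (List Kind) λ es₁ → Σ (List Kind) λ es₂ → Σ (Tm n) λ s →
      Steps es₁ t s × Steps es₂ s u
      × All (λ k → isEvar k ≡ false) es₁ × All (λ k → isEvar k ≡ true) es₂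
      × length (es₁ ++ es₂) ≡ length ds
      × count isM (es₁ ++ es₂) ≡ count isM ds
      × count isE (es₁ ++ es₂) ≡ count isE ds
      × count isEλ (es₁ ++ es₂) ≥ count isEλ ds
lemma5 d with postpone d
... | postponement es₁ es₂ s d₁ d₂ h₁ h₂ q =
  es₁ , es₂ , s , d₁ , d₂ , h₁ , h₂ ,
  sym (⇝-length q) , sym (⇝-count isM refl q) , sym (⇝-count isE refl q) , ⇝-count-eλ q
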